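{- For any two matroids $M_1$ and $M_2$, the set system $\mathcal{I}(M_1\vee M_2)$ satisfies axiom (I3): whenever $I,I'\in\mathcal{I}(M_1\vee M_2)$ with $I'$ maximal in $\mathcal{I}(M_1\vee M_2)$ and $I$ not maximal, there is $x\in I'\setminus I$ with $I+x\in\mathcal{I}(M_1\vee M_2)$.
   Context: Matroids may be infinite: a matroid on $E$ is a pair $(E,\mathcal{I})$ with $\mathcal{I}\subseteq\mathcal{P}(E)$ satisfying (I1) $\emptyset\in\mathcal{I}$; (I2) closure under subsets; (I3) as in the claim; (IM) whenever $I\subseteq X\subseteq E$ and $I\in\mathcal{I}$, the set $\{I'\in\mathcal{I}: I\subseteq I'\subseteq X\}$ has a maximal element. For matroids $M_1,M_2$ on ground sets $E_1,E_2$, $\mathcal{I}(M_1\vee M_2)=\{I_1\cup I_2: I_1\in\mathcal{I}(M_1), I_2\in\mathcal{I}(M_2)\}$, a set system on $E_1\cup E_2$. -}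

module Defs where

open import Level using (0ℓ) renaming (suc to lsuc)
open import Data.Product using (Σ; Σ-syntax; _×_; _,_)
open import Data.Sum using (_⊎_)
open import Data.Empty using (⊥)
open import Relation.Nullary using (¬_)
open import Relation.Binary.PropositionalEquality using (_≡_)

Subset : Set → Set₁
Subset A = A → Set

module _ {A : Set} where

  ∅ : Subset A
  ∅ _ = ⊥

  _⊆_ : Subset A → Subset A → Set
  X ⊆ Y = ∀ {x} → X x → Y x

  _∪_ : Subset A → Subset A → Subset A
  (X ∪ Y) x = X x ⊎ Y x

  _+_ : Subset A → A → Subset A
  (I + a) x = I x ⊎ x ≡ a

  SetSystem : Set₂
  SetSystem = Subset A → Set₁

  Maximal : (Subset A → Set₁) → Subset A → Set₁
  Maximal P J = P J × (∀ K → P K → J ⊆ K → K ⊆ J)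

  AxiomI3 : SetSystem → Set₁
  AxiomI3 𝓘 = ∀ I I' → 𝓘 I → 𝓘 I' → Maximal 𝓘 I' → ¬ Maximal 𝓘 I →
    Σ[ x ∈ A ] (I' x × ¬ I x × 𝓘 (I + x))

-- A (possibly infinite) matroid with ground set E ⊆ A.
record Matroid (A : Set) : Set₂ where
  field
    E   : Subset A
    Ind : Subset A → Set₁
    Ind⊆E : ∀ I → Ind I → I ⊆ E
    I1  : Ind ∅
    I2  : ∀ I J → Ind I → J ⊆ I → Ind J
    I3  : AxiomI3 Ind
    IM  : ∀ I X → I ⊆ X → X ⊆ E → Ind I →
            Σ[ J ∈ Subset A ] Maximal (λ K → Ind K × I ⊆ K × K ⊆ X) J

open Matroid public

-- 𝓘(M₁ ∨ M₂) = { I₁ ∪ I₂ : I₁ ∈ 𝓘(M₁), I₂ ∈ 𝓘(M₂) }, as a set system on A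
-- (its members lie in E₁ ∪ E₂).  Set equality is extensional (⊆ both ways).
UnionInd : {A : Set} → Matroid A → Matroid A → Subset A → Set₁
UnionInd {A} M₁ M₂ I =
  Σ[ I₁ ∈ Subset A ] Σ[ I₂ ∈ Subset A ]
    (Ind M₁ I₁ × Ind M₂ I₂ × I ⊆ (I₁ ∪ I₂) × (I₁ ∪ I₂) ⊆ I)

-- Let I + z ∈ 𝓘 with z ∉ I, let B be maximal, and suppose no element of B ∖ I augments I, so z ∉ B.
-- Split I + z into independent K₁, K₂ and call an element reachable if an alternating chain leads to
-- it from B ∖ I, each step on a side s putting the previous element into Kₛ ∩ I in exchange for the
-- next one.  If a reachable element fitted directly into some Kₛ ∩ I, shifting a shortest chain one
-- step would augment I by its start; hence each reachable element outside Kₛ ∩ I is spanned in Mₛ by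
-- the reachable part of Kₛ ∩ I.  Therefore, on each side, the reachable part of a split of B together
-- with the unreachable part of Kₛ is independent, and these sets cover B + z, contradicting the
-- maximality of B.  The single-matroid steps all reduce to (I3) relative to a subset X of the ground
-- set, where any base of X can supply the augmenting element.

module Submission where

open import Defs
open import Level using (0ℓ)
open import Axiom.ExcludedMiddle using (ExcludedMiddle)
open import Axiom.DoubleNegationElimination using (DoubleNegationElimination; em⇒dne)
open import Data.Bool using (Bool; true; false)
open import Data.Empty using (⊥; ⊥-elim)
open import Function using (case_of_)
open import Data.Nat using (ℕ; zero; suc; _<_; _≤_; _≟_; z≤n; s≤s)
open import Data.Nat.Properties using (≤-refl; <⇒≤; <⇒≢; <-trans; n<1+n; m<n⇒m<1+n; m<1+n⇒m<n∨m≡n)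
open import Data.Nat.Induction using (<-wellFounded)
open import Induction.WellFounded using (Acc; acc)
open import Data.Product using (Σ-syntax; _×_; _,_; proj₁; proj₂)
open import Data.Sum using (_⊎_; inj₁; inj₂; [_,_]; map₁)
open import Relation.Nullary using (¬_; yes; no)
open import Relation.Nullary.Decidable using (True; toWitness; fromWitness)
open import Relation.Unary using (_∩_; _∖_; ｛_｝)
open import Relation.Binary.PropositionalEquality using (_≡_; _≢_; refl; sym; trans; subst)

Augmentation : {A : Set} → SetSystem → Subset A → Subset A → Set₁
Augmentation {A} 𝓘 I J = Σ[ x ∈ A ] (J x × ¬ I x × 𝓘 (I + x))

+-least : {A : Set} {I J : Subset A} {x : A} → I ⊆ J → J x → (I + x) ⊆ J
+-least I⊆J Jx = [ I⊆J , (λ { refl → Jx }) ]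

∖｛｝-+-⊆ : {A : Set} {S : Subset A} {u : A} → S u → ((S ∖ ｛ u ｝) + u) ⊆ S
∖｛｝-+-⊆ Su = [ proj₁ , (λ { refl → Su }) ]

_[_]≔_ : {X : Set} → (ℕ → X) → ℕ → X → ℕ → X
(f [ n ]≔ a) i with i ≟ n
... | yes _ = a
... | no _ = f i

[]≔-updates : {X : Set} (f : ℕ → X) (n : ℕ) (a : X) → (f [ n ]≔ a) n ≡ a
[]≔-updates f n a with n ≟ n
... | yes _ = refl
... | no n≢n = ⊥-elim (n≢n refl)

[]≔-elsewhere : {X : Set} (f : ℕ → X) {n i : ℕ} (a : X) → i ≢ n → (f [ n ]≔ a) i ≡ f i
[]≔-elsewhere f {n} {i} a i≢n with i ≟ n
... | yes i≡n = ⊥-elim (i≢n i≡n)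
... | no _ = refl

module Classical (em₀ : ExcludedMiddle 0ℓ) (em₁ : ExcludedMiddle (Level.suc 0ℓ)) where

  dne₀ : DoubleNegationElimination 0ℓ
  dne₀ = em⇒dne em₀

  dne₁ : DoubleNegationElimination (Level.suc 0ℓ)
  dne₁ = em⇒dne em₁

  module _ {A : Set} where

    ⊆-∖-+ : ∀ {S : Subset A} {b} → S ⊆ ((S ∖ ｛ b ｝) + b)
    ⊆-∖-+ {b = b} {x} Sx with em₀ {b ≡ x}
    ... | yes refl = inj₂ refl
    ... | no b≢x = inj₁ (Sx , b≢x)

    non-maximal-extends : (𝓘 : SetSystem) → (∀ {J K} → 𝓘 K → J ⊆ K → 𝓘 J) →
      ∀ {I} → 𝓘 I → ¬ Maximal 𝓘 I → Σ[ z ∈ A ] (¬ I z × 𝓘 (I + z))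
    non-maximal-extends 𝓘 𝓘-⊆ 𝓘I ¬maxI = dne₁ λ none → ¬maxI (𝓘I , λ K 𝓘K I⊆K {x} Kx →
      dne₀ λ x∉I → none (x , x∉I , 𝓘-⊆ 𝓘K (+-least I⊆K Kx)))

  module MatroidFacts {A : Set} (M : Matroid A) where

    ind-⊆ : ∀ {I J} → Ind M I → J ⊆ I → Ind M J
    ind-⊆ = I2 M _ _

    record IsBase (X B : Subset A) : Set₁ where
      field
        indep : Ind M B
        ⊆X : B ⊆ X
        absorbs : ∀ {x} → X x → Ind M (B + x) → B x

      absorbs-⊇ : ∀ {K x} → Ind M K → B ⊆ K → K x → X x → B x
      absorbs-⊇ indK B⊆K Kx Xx = absorbs Xx (ind-⊆ indK (+-least B⊆K Kx))

    open IsBase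

    extend-to-base : ∀ {I X} → Ind M I → I ⊆ X → X ⊆ E M → Σ[ B ∈ Subset A ] (I ⊆ B × IsBase X B)
    extend-to-base {I} {X} indI I⊆X X⊆E with IM M I X I⊆X X⊆E indI
    ... | B , (indB , I⊆B , B⊆X) , max = B , I⊆B , record
      { indep = indB
      ; ⊆X = B⊆X
      ; absorbs = λ Xx indB+x →
          max _ (indB+x , (λ Ix → inj₁ (I⊆B Ix)) , +-least B⊆X Xx) inj₁ (inj₂ refl)
      }

    base-maximal : ∀ {B} → IsBase (E M) B → Maximal (Ind M) B
    base-maximal base = indep base , λ K indK B⊆K Kx → absorbs-⊇ base indK B⊆K Kx (Ind⊆E M K indK Kx)

    augment-through : ∀ {I K v} → I ⊆ K → ¬ K v → Ind M (K + v) → ¬ I v × Ind M (I + v)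
    augment-through I⊆K v∉K indK+v = (λ Iv → v∉K (I⊆K Iv)) , ind-⊆ indK+v (map₁ I⊆K)

    -- Either K is not maximal, and (I3) against B yields an element that must lie in X, hence in J;
    -- or K is maximal, hence so is P, and (I3) for K ∖ {w} against P yields an element of J.
    private
      module Augment {X J I : Subset A} {w : A} (J-base : IsBase X J) (I+w⊆X : (I + w) ⊆ X)
                     (w∉I : ¬ I w) {B K : Subset A} (B-base : IsBase (E M) B) (J⊆B : J ⊆ B)
                     (K-base : IsBase ((I + w) ∪ (B ∖ X)) K) (I+w⊆K : (I + w) ⊆ K) where

        from-B : ¬ Maximal (Ind M) K → Augmentation (Ind M) I J
        from-B K-not-max with I3 M K B (indep K-base) (indep B-base) (base-maximal B-base) K-not-max
        ... | v , Bv , v∉K , indK+v =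
          v , absorbs-⊇ J-base (indep B-base) J⊆B Bv Xv , augment-through (λ Ix → I+w⊆K (inj₁ Ix)) v∉K indK+v
          where
          Xv : X v
          Xv = dne₀ λ v∉X → v∉K (absorbs K-base (inj₂ (Bv , v∉X)) indK+v)

        P : Subset A
        P = J ∪ (K ∩ (B ∖ X))

        indP : Ind M P
        indP = ind-⊆ (indep B-base) [ J⊆B , (λ KBx → proj₁ (proj₂ KBx)) ]

        maximal-P : Maximal (Ind M) K → Maximal (Ind M) P
        maximal-P K-max = dne₁ λ P-not-max → absurd (I3 M P K indP (indep K-base) K-max P-not-max)
          where
          absurd : Augmentation (Ind M) P K → ⊥
          absurd (v , Kv , v∉P , indP+v) with ⊆X K-base Kv
          ... | inj₁ I+w∋v = v∉P (inj₁ (absorbs J-base (I+w⊆X I+w∋v) (ind-⊆ indP+v (map₁ inj₁))))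
          ... | inj₂ Bv∖X = v∉P (inj₂ (Kv , Bv∖X))

        from-P : Maximal (Ind M) K → Augmentation (Ind M) I J
        from-P K-max with I3 M (K ∖ ｛ w ｝) P (ind-⊆ (indep K-base) proj₁) indP (maximal-P K-max) K∖w-not-max
          where
          K∖w-not-max : ¬ Maximal (Ind M) (K ∖ ｛ w ｝)
          K∖w-not-max (_ , max) = proj₂ (max K (indep K-base) proj₁ (I+w⊆K (inj₂ refl))) refl
        ... | v , inj₁ Jv , v∉K∖w , indK∖w+v =
          v , Jv , augment-through (λ Ix → I+w⊆K (inj₁ Ix) , λ { refl → w∉I Ix }) v∉K∖w indK∖w+v
        ... | v , inj₂ (Kv , _ , v∉X) , v∉K∖w , _ =
          ⊥-elim (v∉K∖w (Kv , λ { refl → v∉X (I+w⊆X (inj₂ refl)) }))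

    augment-from-base : ∀ {X J I w} → IsBase X J → Ind M (I + w) → I ⊆ X → X w → ¬ I w →
                        Augmentation (Ind M) I J
    augment-from-base {J = J} J-base indI+w I⊆X Xw w∉I
      with extend-to-base (indep J-base) (Ind⊆E M J (indep J-base)) (λ e → e)
    ... | B , J⊆B , B-base
      with extend-to-base indI+w inj₁ [ Ind⊆E M _ indI+w , (λ B∖X∋x → Ind⊆E M B (indep B-base) (proj₁ B∖X∋x)) ]
    ... | K , I+w⊆K , K-base with em₁ {Maximal (Ind M) K}
    ...   | no K-not-max = Augment.from-B J-base (+-least I⊆X Xw) w∉I B-base J⊆B K-base I+w⊆K K-not-max
    ...   | yes K-max = Augment.from-P J-base (+-least I⊆X Xw) w∉I B-base J⊆B K-base I+w⊆K K-max

    -- b lies on the fundamental circuit of c in S, and still does in S + a.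
    exchange-persists : ∀ {S a b c} → Ind M (S + a) → ¬ Ind M (S + c) → Ind M ((S ∖ ｛ b ｝) + c) →
                        Ind M (((S + a) ∖ ｛ b ｝) + c)
    exchange-persists {S} {a} {b} {c} indS+a S+c-dep indS∖b+c with em₀ {S a}
    ... | yes Sa = ind-⊆ indS∖b+c (map₁ λ { (inj₁ Sx , b≢x) → Sx , b≢x ; (inj₂ refl , b≢a) → Sa , b≢a })
    ... | no a∉S with em₁ {Ind M (((S ∖ ｛ b ｝) + c) + a)}
    ...   | yes ind = ind-⊆ ind λ { (inj₁ (inj₁ Sx , b≢x)) → inj₁ (inj₁ (Sx , b≢x))
                                  ; (inj₁ (inj₂ refl , _)) → inj₂ refl
                                  ; (inj₂ refl) → inj₁ (inj₂ refl) }
    ...   | no dep with augment-from-base J-base indS+a (λ Sx → inj₁ (inj₁ Sx)) (inj₁ (inj₂ refl)) a∉S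
      where
      S+c⊆J+b : (S + c) ⊆ (((S ∖ ｛ b ｝) + c) + b)
      S+c⊆J+b (inj₁ Sy) = map₁ inj₁ (⊆-∖-+ {S = S} Sy)
      S+c⊆J+b (inj₂ refl) = inj₁ (inj₂ refl)

      J-base : IsBase ((S + a) + c) ((S ∖ ｛ b ｝) + c)
      J-base = record
        { indep = indS∖b+c
        ; ⊆X = map₁ λ S∖b∋x → inj₁ (proj₁ S∖b∋x)
        ; absorbs = λ
            { (inj₁ (inj₁ Sx)) indJ+x → inj₁ (Sx , λ { refl → S+c-dep (ind-⊆ indJ+x S+c⊆J+b) })
            ; (inj₁ (inj₂ refl)) indJ+a → ⊥-elim (dep indJ+a)
            ; (inj₂ refl) _ → inj₂ refl
            }
        }
    ... | v , inj₁ (Sv , _) , v∉S , _ = ⊥-elim (v∉S Sv)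
    ... | v , inj₂ refl , _ , indS+c = ⊥-elim (S+c-dep indS+c)

    exchange-outside : ∀ {S R r} → Ind M S → ¬ Ind M (S + r) → Ind M ((S ∩ R) + r) →
                       Σ[ u ∈ A ] ((S ∖ R) u × Ind M ((S ∖ ｛ u ｝) + r))
    exchange-outside {S} indS S+r-dep indS∩R+r
      with extend-to-base indS∩R+r (map₁ proj₁) (+-least (Ind⊆E M S indS) (Ind⊆E M _ indS∩R+r (inj₂ refl)))
    ... | L , S∩R+r⊆L , L-base with em₀ {Σ[ u ∈ A ] (S u × ¬ L u)}
    ...   | no S⊆L = ⊥-elim (S+r-dep (ind-⊆ (indep L-base)
                       (+-least (λ {x} Sx → dne₀ λ x∉L → S⊆L (x , Sx , x∉L)) (S∩R+r⊆L (inj₂ refl)))))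
    ...   | yes (u , Su , u∉L)
      with augment-from-base L-base (ind-⊆ indS (∖｛｝-+-⊆ Su)) (λ S∖u∋x → inj₁ (proj₁ S∖u∋x)) (inj₁ Su)
                             (λ S∖u∋u → proj₂ S∖u∋u refl)
    ...   | v , Lv , v∉S∖u , indS∖u+v with ⊆X L-base Lv
    ...     | inj₁ Sv = ⊥-elim (v∉S∖u (Sv , λ { refl → u∉L Lv }))
    ...     | inj₂ refl = u , (Su , λ Ru → u∉L (S∩R+r⊆L (inj₁ (Su , Ru)))) , indS∖u+v

    ∪-∖-independent : ∀ {P Y R} → Ind M P → Ind M Y → (∀ {r} → (P ∖ Y) r → ¬ Ind M ((Y ∩ R) + r)) →
                      Ind M (P ∪ (Y ∖ R))
    ∪-∖-independent {P} {Y} {R} indP indY spanned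
      with extend-to-base indP inj₁ [ Ind⊆E M P indP , Ind⊆E M Y indY ]
    ... | L , P⊆L , L-base = ind-⊆ (indep L-base) [ P⊆L , Y∖R⊆L ]
      where
      Y∖R⊆L : (Y ∖ R) ⊆ L
      Y∖R⊆L {u} (Yu , u∉R) = dne₀ λ u∉L → absurd u∉L
        (augment-from-base L-base (ind-⊆ indY (∖｛｝-+-⊆ Yu)) (λ Y∖u∋x → inj₂ (proj₁ Y∖u∋x)) (inj₂ Yu)
                           (λ Y∖u∋u → proj₂ Y∖u∋u refl))
        where
        absurd : ¬ L u → Augmentation (Ind M) (Y ∖ ｛ u ｝) L → ⊥
        absurd u∉L (v , Lv , v∉Y∖u , indY∖u+v) with ⊆X L-base Lv
        ... | inj₂ Yv = v∉Y∖u (Yv , λ { refl → u∉L Lv })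
        ... | inj₁ Pv = spanned (Pv , λ Yv → v∉Y∖u (Yv , λ { refl → u∉L Lv }))
                          (ind-⊆ indY∖u+v (map₁ λ { (Yx , Rx) → Yx , λ { refl → u∉R Rx } }))

  module UnionMatroid {A : Set} (M₁ M₂ : Matroid A) where

    Side : Set
    Side = Bool

    M : Side → Matroid A
    M true = M₁
    M false = M₂

    open module Facts (s : Side) = MatroidFacts (M s) using (ind-⊆; exchange-persists; exchange-outside; ∪-∖-independent)

    Pair : Set₁
    Pair = Side → Subset A

    ⋃ : Pair → Subset A
    ⋃ K x = K true x ⊎ K false x

    Independent : Pair → Set₁
    Independent K = ∀ s → Ind (M s) (K s)

    ⋃-map : ∀ {K K' x} → (∀ s → K s x → K' s x) → ⋃ K x → ⋃ K' x
    ⋃-map f = [ (λ Kx → inj₁ (f true Kx)) , (λ Kx → inj₂ (f false Kx)) ]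

    𝓘 : Subset A → Set₁
    𝓘 = UnionInd M₁ M₂

    𝓘-intro : ∀ {K X} → Independent K → X ⊆ ⋃ K → 𝓘 X
    𝓘-intro {K} {X} indK X⊆K = K∩X true , K∩X false , ind-⊆ true (indK true) proj₁ ,
      ind-⊆ false (indK false) proj₁ , (λ Xx → ⋃-map {K = K} {K' = K∩X} (λ _ Kx → Kx , Xx) (X⊆K Xx)) , [ proj₂ , proj₂ ]
      where
      K∩X : Pair
      K∩X s = K s ∩ X

    𝓘-elim : ∀ {X} → 𝓘 X → Σ[ K ∈ Pair ] (Independent K × X ⊆ ⋃ K)
    𝓘-elim (K₁ , K₂ , indK₁ , indK₂ , X⊆K , _) = K , (λ { true → indK₁ ; false → indK₂ }) , X⊆K
      where
      K : Pair
      K true = K₁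
      K false = K₂

    𝓘-⊆ : ∀ {X Y} → 𝓘 X → Y ⊆ X → 𝓘 Y
    𝓘-⊆ 𝓘X Y⊆X with 𝓘-elim 𝓘X
    ... | K , indK , X⊆K = 𝓘-intro indK (λ Yx → X⊆K (Y⊆X Yx))

    moveTo : Side → A → Pair → Pair
    moveTo true  a K true  = K true + a
    moveTo true  a K false = K false ∖ ｛ a ｝
    moveTo false a K true  = K true ∖ ｛ a ｝
    moveTo false a K false = K false + a

    moveTo-independent : ∀ {K} t {a} → Independent K → Ind (M t) (K t + a) → Independent (moveTo t a K)
    moveTo-independent true  _    indKt+a true  = indKt+a
    moveTo-independent true  indK _       false = ind-⊆ false (indK false) proj₁
    moveTo-independent false indK _       true  = ind-⊆ true (indK true) proj₁
    moveTo-independent false _    indKt+a false = indKt+a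

    moveTo-⋃ : ∀ {K} t a → (⋃ K + a) ⊆ ⋃ (moveTo t a K)
    moveTo-⋃ t a {x} K+a∋x with em₀ {a ≡ x}
    moveTo-⋃ true  a _ | yes refl = inj₁ (inj₂ refl)
    moveTo-⋃ false a _ | yes refl = inj₂ (inj₂ refl)
    moveTo-⋃ t a (inj₂ refl) | no a≢a = ⊥-elim (a≢a refl)
    moveTo-⋃ true  a (inj₁ (inj₁ Kx)) | no _ = inj₁ (inj₁ Kx)
    moveTo-⋃ true  a (inj₁ (inj₂ Kx)) | no a≢x = inj₂ (Kx , a≢x)
    moveTo-⋃ false a (inj₁ (inj₁ Kx)) | no a≢x = inj₁ (Kx , a≢x)
    moveTo-⋃ false a (inj₁ (inj₂ Kx)) | no _ = inj₂ (inj₁ Kx)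

    moveTo-step : ∀ {K} t {a} s {b c} → Ind (M t) (K t + a) → (s ≡ t → ¬ Ind (M t) (K t + c)) →
                  Ind (M s) ((K s ∖ ｛ b ｝) + c) → Ind (M s) ((moveTo t a K s ∖ ｛ b ｝) + c)
    moveTo-step true  true  indKt+a blocked step = exchange-persists true indKt+a (blocked refl) step
    moveTo-step false false indKt+a blocked step = exchange-persists false indKt+a (blocked refl) step
    moveTo-step true  false _ _ step = ind-⊆ false step (map₁ λ { ((Kx , _) , b≢x) → Kx , b≢x })
    moveTo-step false true  _ _ step = ind-⊆ true step (map₁ λ { ((Kx , _) , b≢x) → Kx , b≢x })

    moveTo-other : ∀ {K} t {a} s {c} → s ≢ t → Ind (M s) ((K s ∖ ｛ a ｝) + c) → Ind (M s) (moveTo t a K s + c)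
    moveTo-other true  true  t≢t _ = ⊥-elim (t≢t refl)
    moveTo-other true  false _ ind = ind
    moveTo-other false true  _ ind = ind
    moveTo-other false false t≢t _ = ⊥-elim (t≢t refl)

    Alternating : (ℕ → Side) → ℕ → Set
    Alternating σ m = ∀ {i} → 1 ≤ i → i < m → σ (suc i) ≢ σ i

    -- Chain y₀ → y₁ → ⋯ → yₘ: the i-th step is on side σ (i + 1), which can take in y i by giving up y (i + 1).
    module _ (y : ℕ → A) (σ : ℕ → Side) where

      Steps : Pair → ℕ → Set₁
      Steps K m = ∀ {i} → i < m → Ind (M (σ (suc i))) ((K (σ (suc i)) ∖ ｛ y (suc i) ｝) + y i)

      -- Shifting every element one step back along a chain whose end fits on side t adds y₀ to the
      -- union.  Taking a shortest such chain keeps each step valid while the sides are updated.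
      augment-along : ∀ {m K} t → Acc _<_ m → Independent K → Steps K m → Alternating σ m →
                      (1 ≤ m → t ≢ σ m) → Ind (M t) (K t + y m) →
                      Σ[ K' ∈ Pair ] (Independent K' × (⋃ K + y 0) ⊆ ⋃ K')
      augment-along {zero} t _ indK _ _ _ indKt+y₀ =
        moveTo t (y 0) _ , moveTo-independent t indK indKt+y₀ , moveTo-⋃ t (y 0)
      augment-along {suc n} {K} t (acc shorter) indK steps alternating t≢σm indKt+ym
        with em₁ {Σ[ i ∈ ℕ ] (i < suc n × σ (suc i) ≡ t × Ind (M t) (K t + y i))}
      ... | yes (i , i<m , σ[1+i]≡t , indKt+yi) =
        augment-along t (shorter i<m) indK (λ j<i → steps (<-trans j<i i<m))
          (λ 1≤j j<i → alternating 1≤j (<-trans j<i i<m))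
          (λ 1≤i t≡σi → alternating 1≤i i<m (trans σ[1+i]≡t t≡σi)) indKt+yi
      ... | no no-shortcut
        with augment-along (σ (suc n)) (shorter (n<1+n n)) (moveTo-independent t indK indKt+ym)
               (λ {i} i<n → moveTo-step t (σ (suc i)) indKt+ym
                              (λ σ[1+i]≡t indKt+yi → no-shortcut (i , m<n⇒m<1+n i<n , σ[1+i]≡t , indKt+yi))
                              (steps (m<n⇒m<1+n i<n)))
               (λ 1≤i i<n → alternating 1≤i (m<n⇒m<1+n i<n))
               (λ 1≤n → alternating 1≤n (n<1+n n))
               (moveTo-other t (σ (suc n)) (λ σm≡t → t≢σm (s≤s z≤n) (sym σm≡t)) (steps (n<1+n n)))
      ... | K' , indK' , ⋃K'∋ = K' , indK' , λ K+y₀∋x → ⋃K'∋ (map₁ (λ Kx → moveTo-⋃ t (y (suc n)) (inj₁ Kx)) K+y₀∋x)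

    module NoAugmentation {I B : Subset A} (maxB : Maximal 𝓘 B) (no-aug : ¬ Augmentation 𝓘 I B)
                          {z : A} (z∉I : ¬ I z) (z∉B : ¬ B z)
                          {K : Pair} (indK : Independent K) (I+z⊆K : (I + z) ⊆ ⋃ K) where

      Kᴵ : Pair
      Kᴵ s = K s ∩ I

      indKᴵ : Independent Kᴵ
      indKᴵ s = ind-⊆ s (indK s) proj₁

      I⊆Kᴵ : I ⊆ ⋃ Kᴵ
      I⊆Kᴵ Ix = ⋃-map {K = K} {K' = Kᴵ} (λ _ Kx → Kx , Ix) (I+z⊆K (inj₁ Ix))

      record Chain (r : A) : Set₁ where
        constructor chain
        field
          length : ℕ
          y : ℕ → A
          σ : ℕ → Side
          starts : (B ∖ I) (y 0)
          ends : y length ≡ r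
          steps : Steps y σ Kᴵ length
          alternating : Alternating σ length
          last-in : 1 ≤ length → Kᴵ (σ length) r

      leaves-side : ∀ {r s} (c : Chain r) → ¬ Kᴵ s r → 1 ≤ Chain.length c → s ≢ Chain.σ c (Chain.length c)
      leaves-side c r∉Ks 1≤m refl = r∉Ks (Chain.last-in c 1≤m)

      extend : ∀ {r u} s → Chain r → ¬ Kᴵ s r → Kᴵ s u → Ind (M s) ((Kᴵ s ∖ ｛ u ｝) + r) → Chain u
      extend {r} {u} s c r∉Ks Ksu step = record
        { length = suc m
        ; y = y'
        ; σ = σ'
        ; starts = subst (B ∖ I) (sym (old-y z≤n)) starts
        ; ends = []≔-updates y (suc m) u
        ; steps = steps'
        ; alternating = alternating'
        ; last-in = λ _ → subst (λ t → Kᴵ t u) (sym ([]≔-updates σ (suc m) s)) Ksu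
        }
        where
        open Chain c
        m : ℕ
        m = length
        y' : ℕ → A
        y' = y [ suc m ]≔ u
        σ' : ℕ → Side
        σ' = σ [ suc m ]≔ s
        old-y : ∀ {i} → i ≤ m → y' i ≡ y i
        old-y i≤m = []≔-elsewhere y u (<⇒≢ (s≤s i≤m))
        old-σ : ∀ {i} → i ≤ m → σ' i ≡ σ i
        old-σ i≤m = []≔-elsewhere σ s (<⇒≢ (s≤s i≤m))
        steps' : Steps y' σ' Kᴵ (suc m)
        steps' {i} i<1+m with m<1+n⇒m<n∨m≡n i<1+m
        ... | inj₁ i<m rewrite old-y (<⇒≤ i<m) | old-y i<m | old-σ i<m = steps i<m
        ... | inj₂ refl rewrite old-y ≤-refl | []≔-updates y (suc i) u | []≔-updates σ (suc i) s | ends = step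
        alternating' : Alternating σ' (suc m)
        alternating' {i} 1≤i i<1+m with m<1+n⇒m<n∨m≡n i<1+m
        ... | inj₁ i<m rewrite old-σ i<m | old-σ (<⇒≤ i<m) = alternating 1≤i i<m
        ... | inj₂ refl rewrite []≔-updates σ (suc i) s | old-σ ≤-refl = leaves-side c r∉Ks 1≤i

      -- Chain r lives in Set₁; deciding it with em₁ yields a predicate in Set.
      Reachable : Subset A
      Reachable r = True (em₁ {Chain r})

      reachable-start : ∀ {x} → (B ∖ I) x → Reachable x
      reachable-start {x} B∖I∋x = fromWitness (chain 0 (λ _ → x) (λ _ → true) B∖I∋x refl (λ ()) (λ _ ()) λ ())

      reachable-∖I : ∀ {r} → Reachable r → ¬ I r → B r
      reachable-∖I Rr r∉I with toWitness Rr
      ... | chain zero _ _ (By₀ , _) refl _ _ _ = By₀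
      ... | chain (suc _) _ _ _ _ _ _ last-in = ⊥-elim (r∉I (proj₂ (last-in (s≤s z≤n))))

      reachable-blocked : ∀ {r s} → Reachable r → ¬ Kᴵ s r → ¬ Ind (M s) (Kᴵ s + r)
      reachable-blocked {s = s} Rr r∉Ks indKs+r with toWitness Rr
      ... | c@(chain m y σ (By₀ , y₀∉I) refl steps alternating _)
        with augment-along y σ s (<-wellFounded m) indKᴵ steps alternating (leaves-side c r∉Ks) indKs+r
      ... | K' , indK' , ⋃K'∋ = no-aug (y 0 , By₀ , y₀∉I , 𝓘-intro indK' λ I+y₀∋x → ⋃K'∋ (map₁ I⊆Kᴵ I+y₀∋x))

      reachable-spanned : ∀ {r s} → Reachable r → ¬ Kᴵ s r → ¬ Ind (M s) ((Kᴵ s ∩ Reachable) + r)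
      reachable-spanned {r} {s} Rr r∉Ks indKR+r with em₁ {Ind (M s) (Kᴵ s + r)}
      ... | yes indKs+r = reachable-blocked Rr r∉Ks indKs+r
      ... | no Ks+r-dep with exchange-outside s (indKᴵ s) Ks+r-dep indKR+r
      ...   | u , (Ksu , u∉R) , step = u∉R (fromWitness (extend s (toWitness Rr) r∉Ks Ksu step))

      absurd : ⊥
      absurd with 𝓘-elim (proj₁ maxB)
      ... | Kᴮ , indKᴮ , B⊆Kᴮ = z∉B (proj₂ maxB (⋃ T) (𝓘-intro indT (λ Tx → Tx)) B⊆T z∈T)
        where
        Y : Pair
        Y s = K s ∩ (I + z)

        T : Pair
        T s = (Kᴮ s ∩ Reachable) ∪ (Y s ∖ Reachable)

        indT : Independent T
        indT s = ∪-∖-independent s (ind-⊆ s (indKᴮ s) proj₁) (ind-⊆ s (indK s) proj₁)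
          λ { ((_ , Rr) , r∉Y) indYR+r → reachable-spanned Rr (λ { (Kr , Ir) → r∉Y (Kr , inj₁ Ir) })
                (ind-⊆ s indYR+r (map₁ λ { ((Kx , Ix) , Rx) → (Kx , inj₁ Ix) , Rx })) }

        B⊆T : B ⊆ ⋃ T
        B⊆T {b} Bb with em₀ {Reachable b}
        ... | yes Rb = ⋃-map {K = Kᴮ} {K' = T} (λ _ Kb → inj₁ (Kb , Rb)) (B⊆Kᴮ Bb)
        ... | no b∉R = ⋃-map {K = K} {K' = T} (λ _ Kb → inj₂ ((Kb , inj₁ Ib) , b∉R)) (I+z⊆K (inj₁ Ib))
          where
          Ib : I b
          Ib = dne₀ λ b∉I → b∉R (reachable-start (Bb , b∉I))

        z∈T : ⋃ T z
        z∈T = ⋃-map {K = K} {K' = T} (λ _ Kz → inj₂ ((Kz , inj₂ refl) , λ Rz → z∉B (reachable-∖I Rz z∉I)))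
                (I+z⊆K (inj₂ refl))

    augmentation : ∀ {I B z} → Maximal 𝓘 B → 𝓘 (I + z) → ¬ I z → ¬ B z → Augmentation 𝓘 I B
    augmentation maxB 𝓘I+z z∉I z∉B with 𝓘-elim 𝓘I+z
    ... | K , indK , I+z⊆K = dne₁ λ no-aug → NoAugmentation.absurd maxB no-aug z∉I z∉B indK I+z⊆K

proposition4p2 : ExcludedMiddle 0ℓ → ExcludedMiddle (Level.suc 0ℓ) →
    {A : Set} → (M₁ M₂ : Matroid A) → AxiomI3 (UnionInd M₁ M₂)
proposition4p2 em₀ em₁ M₁ M₂ I B 𝓘I _ maxB ¬maxI =
  let z , z∉I , 𝓘I+z = non-maximal-extends 𝓘 𝓘-⊆ 𝓘I ¬maxI in
  case em₀ {B z} of λ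
    { (yes Bz) → z , Bz , z∉I , 𝓘I+z
    ; (no z∉B) → augmentation maxB 𝓘I+z z∉I z∉B
    }
  where
  open Classical em₀ em₁
  open UnionMatroid M₁ M₂
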